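{- (Weak transitivity) For all $\alpha,\beta,\gamma\in For$: if $\{\alpha\}\vDash^{\mathbb{P}}_{L_3}\beta$ and $\{\beta\}\vDash^{\mathbb{P}}_{L_3}\gamma$, then $\{\alpha\}\vDash^{\mathbb{P}}_{L_3}\gamma$.
   Context: $For$ is the set of formulas built from a countable set $Prop$ of propositional letters with $\neg,\vee,\wedge,\rightarrow$. $L_3$ (Łukasiewicz) is given by the matrix with truth values $\{0,1/2,1\}$, designated set $\{1\}$, $f_\neg(x)=1-x$, $f_\vee=\max$, $f_\wedge=\min$, $f_\rightarrow(x,y)=\min\{1,1-x+y\}$; valuations are maps $Prop\to\{0,1/2,1\}$ extended via these functions. $\Gamma\vDash_{L_3}\alpha$ iff every valuation giving all members of $\Gamma$ value $1$ gives $\alpha$ value $1$; $\Gamma$ is $L_3$-consistent iff $\{\alpha:\Gamma\vDash_{L_3}\alpha\}\neq For$. $\Gamma\vDash^{\mathbb{P}}_{L_3}\alpha$ iff there exists an $L_3$-consistent $\Gamma'\subseteq\Gamma$ with $\Gamma'\vDash_{L_3}\alpha$. -}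

module Defs where

open import Data.Nat using (ℕ)
open import Data.Product using (Σ; ∃; _×_; _,_)
open import Relation.Binary.PropositionalEquality using (_≡_)
open import Relation.Nullary using (¬_)
open import Level using (0ℓ)

Prop' : Set
Prop' = ℕ

data For : Set where
  var  : Prop' → For
  ¬'_  : For → For
  _∨'_ : For → For → For
  _∧'_ : For → For → For
  _⇒'_ : For → For → For

-- Truth values {0, 1/2, 1}
data V : Set where
  v0 vh v1 : V

f¬ : V → V
f¬ v0 = v1
f¬ vh = vh
f¬ v1 = v0

f∨ : V → V → V   -- max
f∨ v0 y = y
f∨ vh v0 = vh
f∨ vh vh = vh
f∨ vh v1 = v1
f∨ v1 y = v1

f∧ : V → V → V   -- min
f∧ v0 y = v0
f∧ vh v0 = v0
f∧ vh vh = vh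
f∧ vh v1 = vh
f∧ v1 y = y

-- min{1, 1 - x + y}
f⇒ : V → V → V
f⇒ v0 y  = v1
f⇒ vh v0 = vh
f⇒ vh vh = v1
f⇒ vh v1 = v1
f⇒ v1 y  = y

Valuation : Set
Valuation = Prop' → V

⟦_⟧ : For → Valuation → V
⟦ var p ⟧ v = v p
⟦ ¬' a ⟧ v = f¬ (⟦ a ⟧ v)
⟦ a ∨' b ⟧ v = f∨ (⟦ a ⟧ v) (⟦ b ⟧ v)
⟦ a ∧' b ⟧ v = f∧ (⟦ a ⟧ v) (⟦ b ⟧ v)
⟦ a ⇒' b ⟧ v = f⇒ (⟦ a ⟧ v) (⟦ b ⟧ v)

FSet : Set₁
FSet = For → Set

_⊆_ : FSet → FSet → Set
Γ ⊆ Δ = ∀ φ → Γ φ → Δ φ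

⟨_⟩ : For → FSet
⟨ α ⟩ φ = φ ≡ α

_⊨L3_ : FSet → For → Set
Γ ⊨L3 α = ∀ (v : Valuation) → (∀ φ → Γ φ → ⟦ φ ⟧ v ≡ v1) → ⟦ α ⟧ v ≡ v1

Consistent : FSet → Set
Consistent Γ = ∃ λ φ → ¬ (Γ ⊨L3 φ)

_⊨P_ : FSet → For → Set₁
Γ ⊨P α = Σ FSet λ Γ' → (Γ' ⊆ Γ) × Consistent Γ' × (Γ' ⊨L3 α)

-- The consistent subset Γ' ⊆ {α} witnessing α ⊨ᴾ β also witnesses α ⊨ᴾ γ: the subset of {β}
-- used for β ⊨ᴾ γ can only contain β, which Γ' entails, so cutting it out gives Γ' ⊨ γ.
module Submission where

open import Defs
open import Data.Product using (_,_)
open import Relation.Binary.PropositionalEquality using (refl)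

⊨L3-cut : ∀ {Γ Δ} γ → (∀ φ → Δ φ → Γ ⊨L3 φ) → Δ ⊨L3 γ → Γ ⊨L3 γ
⊨L3-cut γ Γ⊨Δ Δ⊨γ v Γ-true = Δ⊨γ v (λ φ φ∈Δ → Γ⊨Δ φ φ∈Δ v Γ-true)

⊆⟨⟩-entailed : ∀ {Γ Δ β} → Δ ⊆ ⟨ β ⟩ → Γ ⊨L3 β → ∀ φ → Δ φ → Γ ⊨L3 φ
⊆⟨⟩-entailed Δ⊆β Γ⊨β φ φ∈Δ with Δ⊆β φ φ∈Δ
... | refl = Γ⊨β

proposition11 : ∀ (α β γ : For) → ⟨ α ⟩ ⊨P β → ⟨ β ⟩ ⊨P γ → ⟨ α ⟩ ⊨P γ
proposition11 α β γ (Γ , Γ⊆α , Γ-consistent , Γ⊨β) (Δ , Δ⊆β , _ , Δ⊨γ) =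
  Γ , Γ⊆α , Γ-consistent , ⊨L3-cut γ (⊆⟨⟩-entailed Δ⊆β Γ⊨β) Δ⊨γ
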